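{- Let $X$ be a shift space on the alphabet $A$, let $n\ge1$, $m\ge0$, and let $V\subset\mathcal L(X)$ be a finite $X$-maximal prefix code. If $\mathcal E_{\mathcal L_n(X),V}(w)$ is a tree for every $w\in\mathcal L_{\ge m}(X)$, then for every $w\in\mathcal L_{\ge m}(X)$ and every word $\ell\in\mathcal L_{\ge n-1}(X)$ with $\ell w\in\mathcal L(X)$, the graph $\mathcal E_{A,V}(\ell w)$ is a tree.
   Context: A shift space on a finite alphabet $A$ is a closed shift-invariant subset of $A^{\mathbb Z}$; $\mathcal L(X)$ is its set of finite factors, $\mathcal L_n(X)$ those of length $n$, $\mathcal L_{\ge n}(X)$ those of length at least $n$. A prefix code is a set of words none of which is a proper prefix of another; a prefix code $V\subset\mathcal L(X)$ is $X$-maximal if it is not properly contained in a prefix code contained in $\mathcal L(X)$. For sets of words $U,V$ and $w\in\mathcal L(X)$, let $L_U(w)=\{u\in U: uw\in\mathcal L(X)\}$, $R_V(w)=\{v\in V: wv\in\mathcal L(X)\}$; the generalized extension graph $\mathcal E_{U,V}(w)$ is the undirected bipartite graph with vertex set the disjoint union of $L_U(w)$ and $R_V(w)$ and edges the pairs $(u,v)\in L_U(w)\times R_V(w)$ with $uwv\in\mathcal L(X)$. In $\mathcal E_{A,V}$, $A$ denotes the set of letters. -}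

module Defs where

open import Data.Nat as ℕ using (ℕ; _≤_)
open import Data.Integer as ℤ using (ℤ; +_; _+_; _-_; ∣_∣)
open import Data.Fin using (Fin)
open import Data.List using (List; []; _∷_; _++_; map; upTo; length)
open import Data.List.Membership.Propositional using (_∈_)
open import Data.List.Relation.Unary.Unique.Propositional using (Unique)
open import Data.List.Relation.Unary.Linked using (Linked)
open import Data.Product using (Σ; ∃; _×_; _,_)
open import Data.Sum using (_⊎_; inj₁; inj₂)
open import Data.Empty using (⊥)
open import Relation.Nullary using (¬_)
open import Relation.Binary.PropositionalEquality using (_≡_; _≢_)

Word : ℕ → Set
Word k = List (Fin k)

Config : ℕ → Set
Config k = ℤ → Fin k

window : ∀ {k} → Config k → ℤ → ℕ → Word k
window x i n = map (λ j → x (i + + j)) (upTo n)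

IsClosed : ∀ {k} → (Config k → Set) → Set
IsClosed {k} X = ∀ (x : Config k) →
  (∀ (N : ℕ) → ∃ λ (y : Config k) → X y × (∀ (i : ℤ) → ∣ i ∣ ≤ N → y i ≡ x i)) →
  X x

IsShiftInvariant : ∀ {k} → (Config k → Set) → Set
IsShiftInvariant {k} X = ∀ (x : Config k) →
  (X x → X (λ i → x (i + + 1))) × (X x → X (λ i → x (i - + 1)))

record IsShiftSpace {k : ℕ} (X : Config k → Set) : Set where
  field
    closed    : IsClosed X
    invariant : IsShiftInvariant X

_∈L_ : ∀ {k} → Word k → (Config k → Set) → Set
_∈L_ {k} w X = ∃ λ (x : Config k) → X x × ∃ λ (i : ℤ) → window x i (length w) ≡ w

Lang : ∀ {k} → (Config k → Set) → ℕ → Word k → Set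
Lang X n u = (u ∈L X) × length u ≡ n

-- the set A of letters, seen as words of length one
Letters : ∀ {k} → Word k → Set
Letters u = ∃ λ a → u ≡ a ∷ []

ProperPrefix : ∀ {k} → Word k → Word k → Set
ProperPrefix u v = ∃ λ s → s ≢ [] × u ++ s ≡ v

IsPrefixCode : ∀ {k} → (Word k → Set) → Set
IsPrefixCode P = ∀ u v → P u → P v → ¬ ProperPrefix u v

IsXMaximalPrefixCode : ∀ {k} → (Config k → Set) → List (Word k) → Set₁
IsXMaximalPrefixCode {k} X V =
  IsPrefixCode (_∈ V) ×
  (∀ v → v ∈ V → v ∈L X) ×
  (∀ (W : Word k → Set) → IsPrefixCode W → (∀ u → W u → u ∈L X) →
     (∀ v → v ∈ V → W v) → ∀ u → W u → u ∈ V)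

record Graph : Set₁ where
  field
    Vtx   : Set
    IsVtx : Vtx → Set
    Adj   : Vtx → Vtx → Set   -- symmetric; only relates vertices

open Graph

data Walk (G : Graph) : Vtx G → Vtx G → Set where
  here : ∀ {x} → IsVtx G x → Walk G x x
  step : ∀ {x y z} → Adj G x y → Walk G y z → Walk G x z

Connected : Graph → Set
Connected G = (∃ λ x → IsVtx G x) × (∀ x y → IsVtx G x → IsVtx G y → Walk G x y)

last : ∀ {A : Set} → A → List A → A
last a [] = a
last a (b ∷ bs) = last b bs

Cycle : (G : Graph) → List (Vtx G) → Set
Cycle G [] = ⊥
Cycle G (v₀ ∷ []) = ⊥
Cycle G (v₀ ∷ v₁ ∷ []) = ⊥
Cycle G (v₀ ∷ v₁ ∷ v₂ ∷ vs) =
  Unique (v₀ ∷ v₁ ∷ v₂ ∷ vs) × Linked (Adj G) (v₀ ∷ v₁ ∷ v₂ ∷ vs) ×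
  Adj G (last v₂ vs) v₀

Acyclic : Graph → Set
Acyclic G = ∀ vs → ¬ Cycle G vs

IsTree : Graph → Set
IsTree G = Connected G × Acyclic G

-- Generalized extension graph E_{U,V}(w): left vertices inj₁ u with
-- u ∈ L_U(w), right vertices inj₂ v with v ∈ R_V(w), edges u — v
-- with u w v ∈ L(X)

ExtGraph : ∀ {k} → (Config k → Set) → (Word k → Set) → (Word k → Set) →
           Word k → Graph
ExtGraph {k} X U V w = record
  { Vtx   = Word k ⊎ Word k
  ; IsVtx = isV
  ; Adj   = adj
  }
  where
  isV : Word k ⊎ Word k → Set
  isV (inj₁ u) = U u × (u ++ w) ∈L X
  isV (inj₂ v) = V v × (w ++ v) ∈L X
  edge : Word k → Word k → Set
  edge u v = isV (inj₁ u) × isV (inj₂ v) × (u ++ w ++ v) ∈L X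
  adj : Word k ⊎ Word k → Word k ⊎ Word k → Set
  adj (inj₁ u) (inj₂ v) = edge u v
  adj (inj₂ v) (inj₁ u) = edge u v
  adj (inj₁ _) (inj₁ _) = ⊥
  adj (inj₂ _) (inj₂ _) = ⊥

module Submission where

-- Write n = 1 + n′.  Both halves of "E_{A,V}(ℓw) is a tree" are obtained
-- by comparing it with an extension graph that is a tree by hypothesis,
-- through a graph homomorphism acting on left vertices only.
--
-- * Connectedness.  Sending a left vertex x ∈ L_n(X) of E_{L_n,V}(ℓw)
--   to its last letter is a homomorphism onto E_{A,V}(ℓw); it is
--   surjective on vertices because every factor a·ℓw extends to the left
--   by n′ letters.  Images of connected graphs under such maps are
--   connected.
-- * Acyclicity.  Split ℓ = s·u with |s| = n′ and put z = u·w, so that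
--   |z| ≥ m.  Sending a letter a to a·s is an injective homomorphism
--   from E_{A,V}(s·z) into E_{L_n,V}(z), and injective homomorphisms
--   reflect acyclicity.
--
-- Only the factor structure of L(X) is used: neither the shift-space
-- axioms nor the maximality of the prefix code V enter the argument.

open import Defs
open import Data.Nat using (ℕ; _≤_; _∸_)
open import Data.List using (List; _++_; length)
open import Data.List.Membership.Propositional using (_∈_)

open import Data.Nat as ℕ using (zero; suc; s≤s)
import Data.Nat.Properties as ℕP
open import Data.Integer as ℤ using (ℤ; +_; _-_; -_)
import Data.Integer.Properties as ℤP
open import Data.List using ([]; _∷_; map; applyUpTo)
import Data.List.Properties as ListP
open import Data.Fin using (Fin)
open import Data.Product using (∃; _×_; _,_; proj₁; proj₂)
open import Data.Sum using (inj₁; inj₂; map₁)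
open import Data.Sum.Properties using (inj₁-injective)
open import Function.Definitions using (Injective)
open import Relation.Binary.PropositionalEquality
import Data.List.Relation.Unary.Linked as Linked
import Data.List.Relation.Unary.Linked.Properties as LinkedP
import Data.List.Relation.Unary.Unique.Propositional.Properties as UniqueP

open Graph

++-injective-by-length : ∀ {A : Set} (as bs cs ds : List A) →
  as ++ bs ≡ cs ++ ds → length as ≡ length cs → as ≡ cs × bs ≡ ds
++-injective-by-length []       bs []       ds e _ = refl , e
++-injective-by-length (a ∷ as) bs (c ∷ cs) ds e l
  with refl , e′ ← ListP.∷-injective e
  with refl , e″ ← ++-injective-by-length as bs cs ds e′ (ℕP.suc-injective l)
  = refl , e″

split-at : ∀ {A : Set} n (ℓ : List A) → n ≤ length ℓ →
  ∃ λ s → ∃ λ u → length s ≡ n × ℓ ≡ s ++ u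
split-at zero    ℓ       _       = [] , ℓ , refl , refl
split-at (suc n) (a ∷ ℓ) (s≤s p) with s , u , refl , refl ← split-at n ℓ p
  = a ∷ s , u , refl , refl

≤-length-++ : ∀ {A : Set} {m} (p w : List A) → m ≤ length w → m ≤ length (p ++ w)
≤-length-++ p w m≤w = ℕP.≤-trans m≤w
  (subst (length w ≤_) (sym (ListP.length-++ p)) (ℕP.m≤n+m (length w) (length p)))

module _ {k : ℕ} where

  -- The word x_i x_{i+1} ⋯ x_{i+n-1}, defined by recursion on n; it agrees
  -- with `window` and is the form used for induction.
  segment : Config k → ℤ → ℕ → Word k
  segment x i zero    = []
  segment x i (suc n) = x i ∷ segment x (i ℤ.+ + 1) n

  window≡segment : ∀ (x : Config k) i n → window x i n ≡ segment x i n
  window≡segment x i n = trans (ListP.map-upTo (λ j → x (i ℤ.+ + j)) n) (go i n (λ _ → refl))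
    where
    go : ∀ {f : ℕ → Fin k} i n → (∀ j → f j ≡ x (i ℤ.+ + j)) → applyUpTo f n ≡ segment x i n
    go i zero    _ = refl
    go i (suc n) h = cong₂ _∷_ (trans (h 0) (cong x (ℤP.+-identityʳ i)))
      (go (i ℤ.+ + 1) n (λ j → trans (h (suc j)) (cong x (sym (ℤP.+-assoc i (+ 1) (+ j))))))

  length-segment : ∀ (x : Config k) i n → length (segment x i n) ≡ n
  length-segment x i zero    = refl
  length-segment x i (suc n) = cong suc (length-segment x (i ℤ.+ + 1) n)

  segment-++ : ∀ (x : Config k) i a b →
    segment x i (a ℕ.+ b) ≡ segment x i a ++ segment x (i ℤ.+ + a) b
  segment-++ x i zero    b = cong (λ j → segment x j b) (sym (ℤP.+-identityʳ i))
  segment-++ x i (suc a) b = cong (x i ∷_) (trans (segment-++ x (i ℤ.+ + 1) a b)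
    (cong (λ j → segment x (i ℤ.+ + 1) a ++ segment x j b) (ℤP.+-assoc i (+ 1) (+ a))))

  ∈L-segment : ∀ {X : Config k → Set} {x} → X x → ∀ i n → segment x i n ∈L X
  ∈L-segment {x = x} Xx i n = x , Xx , i ,
    trans (window≡segment x i _) (cong (segment x i) (length-segment x i n))

  factor-closed : ∀ {X : Config k → Set} (p y q : Word k) → (p ++ y ++ q) ∈L X → y ∈L X
  factor-closed p y q (x , Xx , i , e) =
    subst (_∈L _) (proj₁ y-part) (∈L-segment Xx (i ℤ.+ + length p) (length y))
    where
    i′ = i ℤ.+ + length p
    pyq : segment x i (length p ℕ.+ (length y ℕ.+ length q)) ≡ p ++ y ++ q
    pyq = begin
      segment x i (length p ℕ.+ (length y ℕ.+ length q))
        ≡⟨ cong (segment x i) (sym (trans (ListP.length-++ p) (cong (length p ℕ.+_) (ListP.length-++ y)))) ⟩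
      segment x i (length (p ++ y ++ q))
        ≡⟨ sym (window≡segment x i _) ⟩
      window x i (length (p ++ y ++ q))
        ≡⟨ e ⟩
      p ++ y ++ q ∎
      where open ≡-Reasoning
    yq-part = ++-injective-by-length _ _ p (y ++ q)
      (trans (sym (segment-++ x i (length p) _)) pyq) (length-segment x i _)
    y-part = ++-injective-by-length _ _ y q
      (trans (sym (segment-++ x i′ (length y) _)) (proj₂ yq-part)) (length-segment x i′ _)

  prefix-closed : ∀ {X : Config k → Set} (y q : Word k) → (y ++ q) ∈L X → y ∈L X
  prefix-closed y q = factor-closed [] y q

  suffix-closed : ∀ {X : Config k → Set} (p y : Word k) → (p ++ y) ∈L X → y ∈L X
  suffix-closed p y h =
    factor-closed p y [] (subst (_∈L _) (cong (p ++_) (sym (ListP.++-identityʳ y))) h)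

  -- Every word of L(X) extends to the left by any number j of letters:
  -- read the j letters preceding an occurrence in a point of X.
  left-extendable : ∀ {X : Config k → Set} (y : Word k) → y ∈L X →
    ∀ j → ∃ λ t → length t ≡ j × (t ++ y) ∈L X
  left-extendable y (x , Xx , i , e) j =
    segment x (i - + j) j , length-segment x _ j ,
    subst (_∈L _) ty (∈L-segment Xx (i - + j) (j ℕ.+ length y))
    where
    back-and-forth : (i - + j) ℤ.+ + j ≡ i
    back-and-forth = trans (ℤP.+-assoc i (- + j) (+ j))
      (trans (cong (λ j′ → i ℤ.+ j′) (ℤP.+-inverseˡ (+ j))) (ℤP.+-identityʳ i))
    ty : segment x (i - + j) (j ℕ.+ length y) ≡ segment x (i - + j) j ++ y
    ty = begin
      segment x (i - + j) (j ℕ.+ length y)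
        ≡⟨ segment-++ x (i - + j) j (length y) ⟩
      segment x (i - + j) j ++ segment x ((i - + j) ℤ.+ + j) (length y)
        ≡⟨ cong (λ i′ → segment x (i - + j) j ++ segment x i′ (length y)) back-and-forth ⟩
      segment x (i - + j) j ++ segment x i (length y)
        ≡⟨ cong (segment x (i - + j) j ++_) (trans (sym (window≡segment x i _)) e) ⟩
      segment x (i - + j) j ++ y ∎
      where open ≡-Reasoning

record Hom (G H : Graph) : Set where
  field
    fun    : Vtx G → Vtx H
    vertex : ∀ x → IsVtx G x → IsVtx H (fun x)
    edge   : ∀ x y → Adj G x y → Adj H (fun x) (fun y)

open Hom

VertexSurjective : ∀ {G H} → Hom G H → Set
VertexSurjective {G} {H} φ = ∀ y → IsVtx H y → ∃ λ x → IsVtx G x × fun φ x ≡ y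

map-walk : ∀ {G H} (φ : Hom G H) {x y} → Walk G x y → Walk H (fun φ x) (fun φ y)
map-walk φ (here {x} v)       = here (vertex φ x v)
map-walk φ (step {x} {y} a w) = step (edge φ x y a) (map-walk φ w)

connected-image : ∀ {G H} (φ : Hom G H) → VertexSurjective φ → Connected G → Connected H
connected-image {H = H} φ onto ((x₀ , v₀) , walks) =
  (fun φ x₀ , vertex φ x₀ v₀) , λ y₁ y₂ v₁ v₂ →
    let (x₁ , u₁ , e₁) = onto y₁ v₁
        (x₂ , u₂ , e₂) = onto y₂ v₂
    in subst₂ (Walk H) e₁ e₂ (map-walk φ (walks x₁ x₂ u₁ u₂))

last-map : ∀ {A B : Set} (f : A → B) a bs → last (f a) (map f bs) ≡ f (last a bs)
last-map f a []       = refl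
last-map f a (b ∷ bs) = last-map f b bs

-- An injective homomorphism maps cycles to cycles, so acyclicity of H
-- is inherited by G.
acyclic-preimage : ∀ {G H} (φ : Hom G H) → Injective _≡_ _≡_ (fun φ) → Acyclic H → Acyclic G
acyclic-preimage {H = H} φ inj acyclic (v₀ ∷ v₁ ∷ v₂ ∷ vs) (unique , linked , closing) =
  acyclic (map (fun φ) (v₀ ∷ v₁ ∷ v₂ ∷ vs))
    ( UniqueP.map⁺ inj unique
    , LinkedP.map⁺ (Linked.map (λ {x} {y} → edge φ x y) linked)
    , subst (λ x → Adj H x (fun φ v₀)) (sym (last-map (fun φ) v₂ vs)) (edge φ _ _ closing))

module _ {k : ℕ} (X : Config k → Set) {U U′ P : Word k → Set} {w w′ : Word k} where

  ext-hom : (f : Word k → Word k) →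
    (∀ u → U u → (u ++ w) ∈L X → U′ (f u) × (f u ++ w′) ∈L X) →
    (∀ v → (w ++ v) ∈L X → (w′ ++ v) ∈L X) →
    (∀ u v → U u → (u ++ w ++ v) ∈L X → (f u ++ w′ ++ v) ∈L X) →
    Hom (ExtGraph X U P w) (ExtGraph X U′ P w′)
  ext-hom f left right middle = record
    { fun    = map₁ f
    ; vertex = vertex′
    ; edge   = edge′
    }
    where
    G = ExtGraph X U P w
    H = ExtGraph X U′ P w′
    vertex′ : ∀ x → IsVtx G x → IsVtx H (map₁ f x)
    vertex′ (inj₁ u) (Uu , uw) = left u Uu uw
    vertex′ (inj₂ v) (Pv , wv) = Pv , right v wv
    uv-edge : ∀ u v → Adj G (inj₁ u) (inj₂ v) → Adj H (inj₁ (f u)) (inj₂ v)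
    uv-edge u v (vu@(Uu , _) , vv , uwv) =
      vertex′ (inj₁ u) vu , vertex′ (inj₂ v) vv , middle u v Uu uwv
    edge′ : ∀ x y → Adj G x y → Adj H (map₁ f x) (map₁ f y)
    edge′ (inj₁ u) (inj₂ v) a = uv-edge u v a
    edge′ (inj₂ v) (inj₁ u) a = uv-edge u v a

module _ {k : ℕ} where

  lastLetter : Word k → Word k
  lastLetter []          = []
  lastLetter (a ∷ [])    = a ∷ []
  lastLetter (a ∷ b ∷ x) = lastLetter (b ∷ x)

  lastLetter-split : ∀ a (x : Word k) →
    ∃ λ t → a ∷ x ≡ t ++ lastLetter (a ∷ x) × Letters (lastLetter (a ∷ x))
  lastLetter-split a []      = [] , refl , a , refl
  lastLetter-split a (b ∷ x) with t , e , l ← lastLetter-split b x = a ∷ t , cong (a ∷_) e , l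

  lastLetter-snoc : ∀ (t : Word k) a → lastLetter (t ++ a ∷ []) ≡ a ∷ []
  lastLetter-snoc []          a = refl
  lastLetter-snoc (b ∷ [])    a = refl
  lastLetter-snoc (b ∷ c ∷ t) a = lastLetter-snoc (c ∷ t) a

  lastLetter-suffix : ∀ {X : Config k → Set} a (x r : Word k) →
    ((a ∷ x) ++ r) ∈L X → (lastLetter (a ∷ x) ++ r) ∈L X
  lastLetter-suffix a x r h with t , e , _ ← lastLetter-split a x =
    suffix-closed t _ (subst (_∈L _) (trans (cong (_++ r) e) (ListP.++-assoc t _ r)) h)

  module _ (X : Config k → Set) (P : Word k → Set) (n : ℕ) (w : Word k) where

    lastLetter-hom : Hom (ExtGraph X (Lang X (suc n)) P w) (ExtGraph X Letters P w)
    lastLetter-hom = ext-hom X lastLetter left (λ _ wv → wv) middle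
      where
      left : ∀ u → Lang X (suc n) u → (u ++ w) ∈L X →
        Letters (lastLetter u) × (lastLetter u ++ w) ∈L X
      left (a ∷ x) _ uw = proj₂ (proj₂ (lastLetter-split a x)) , lastLetter-suffix a x w uw
      middle : ∀ u v → Lang X (suc n) u → (u ++ w ++ v) ∈L X → (lastLetter u ++ w ++ v) ∈L X
      middle (a ∷ x) v _ uwv = lastLetter-suffix a x (w ++ v) uwv

    -- Each letter a with a·w ∈ L(X) is the last letter of a vertex of
    -- E_{L_{n+1},P}(w): extend a·w to the left by n letters.
    lastLetter-onto : VertexSurjective lastLetter-hom
    lastLetter-onto (inj₂ v) vv = inj₂ v , vv , refl
    lastLetter-onto (inj₁ _) ((a , refl) , aw) with t , |t| , taw ← left-extendable (a ∷ w) aw n =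
      inj₁ (t ++ a ∷ []) , ((prefix-closed _ w ta-w , |ta|) , ta-w) , cong inj₁ (lastLetter-snoc t a)
      where
      ta-w : ((t ++ a ∷ []) ++ w) ∈L X
      ta-w = subst (_∈L X) (sym (ListP.++-assoc t (a ∷ []) w)) taw
      |ta| : length (t ++ a ∷ []) ≡ suc n
      |ta| = trans (ListP.length-++ t) (trans (cong (ℕ._+ 1) |t|) (ℕP.+-comm n 1))

module _ {k : ℕ} (X : Config k → Set) (P : Word k → Set) (s z : Word k) where

  append-hom : Hom (ExtGraph X Letters P (s ++ z)) (ExtGraph X (Lang X (suc (length s))) P z)
  append-hom = ext-hom X (_++ s) left right middle
    where
    left : ∀ u → Letters u → (u ++ s ++ z) ∈L X →
      Lang X (suc (length s)) (u ++ s) × ((u ++ s) ++ z) ∈L X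
    left _ (a , refl) asz = (prefix-closed (a ∷ s) z asz , refl) , asz
    right : ∀ v → ((s ++ z) ++ v) ∈L X → (z ++ v) ∈L X
    right v szv = suffix-closed s _ (subst (_∈L X) (ListP.++-assoc s z v) szv)
    middle : ∀ u v → Letters u → (u ++ (s ++ z) ++ v) ∈L X → ((u ++ s) ++ z ++ v) ∈L X
    middle _ v (a , refl) aszv = subst (_∈L X) (cong (a ∷_) (ListP.++-assoc s z v)) aszv

  append-injective : Injective _≡_ _≡_ (fun append-hom)
  append-injective {inj₁ u} {inj₁ u′} e = cong inj₁ (ListP.++-cancelʳ s u u′ (inj₁-injective e))
  append-injective {inj₂ v} {inj₂ _}  refl = refl

lemma8p3 : ∀ {k : ℕ} (X : Config k → Set) → IsShiftSpace X →
    (n m : ℕ) → 1 ≤ n →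
    (V : List (Word k)) → IsXMaximalPrefixCode X V →
    (∀ (w : Word k) → w ∈L X → m ≤ length w →
    IsTree (ExtGraph X (Lang X n) (_∈ V) w)) →
    ∀ (w ℓ : Word k) → w ∈L X → m ≤ length w →
    ℓ ∈L X → n ∸ 1 ≤ length ℓ → (ℓ ++ w) ∈L X →
    IsTree (ExtGraph X Letters (_∈ V) (ℓ ++ w))
lemma8p3 X _ (suc n) m _ V _ tree w ℓ _ m≤w _ n≤ℓ ℓw
  with s , u , refl , refl ← split-at n ℓ n≤ℓ =
  connected , subst (λ x → Acyclic (ExtGraph X Letters (_∈ V) x)) (sym (ListP.++-assoc s u w)) acyclic
  where
  z = u ++ w
  connected : Connected (ExtGraph X Letters (_∈ V) ((s ++ u) ++ w))
  connected = connected-image (lastLetter-hom X (_∈ V) n _) (lastLetter-onto X (_∈ V) n _)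
    (proj₁ (tree _ ℓw (≤-length-++ (s ++ u) w m≤w)))
  z∈L : z ∈L X
  z∈L = suffix-closed s z (subst (_∈L X) (ListP.++-assoc s u w) ℓw)
  acyclic : Acyclic (ExtGraph X Letters (_∈ V) (s ++ z))
  acyclic = acyclic-preimage (append-hom X (_∈ V) s z) (append-injective X (_∈ V) s z)
    (proj₂ (tree z z∈L (≤-length-++ u w m≤w)))
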